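{- Let $B$ be a non-unital B0-system and let $\delta_1,\delta_2$ be two families of maps $\delta_k:B_{n+1}\to\widetilde B_{n+2}$ ($n\ge0$), each of which makes $B$ a unital B0-system. Suppose that both $\delta_1$ and $\delta_2$ satisfy the $\delta$T-condition, the $\delta$Sid-condition and the S$\delta$T-condition. Then $\delta_1=\delta_2$.
   Context: A non-unital pre-B-system consists of sets $B_n,\widetilde B_{n+1}$ ($n\ge0$), maps $ft:B_{n+1}\to B_n$, $\partial:\widetilde B_{n+1}\to B_{n+1}$, $pt\in B_0$, and for $m\ge n\ge 0$ maps $T(Y,X)\in B_{m+2}$ for $Y\in B_{n+1},X\in B_{m+1}$ with $ft(Y)=ft^{m+1-n}(X)$; $\widetilde T(Y,r)\in\widetilde B_{m+2}$ for $Y\in B_{n+1},r\in\widetilde B_{m+1}$ with $ft(Y)=ft^{m+1-n}(\partial r)$; $S(s,X)\in B_{m+1}$ for $s\in\widetilde B_{n+1},X\in B_{m+2}$ with $\partial(s)=ft^{m+1-n}(X)$; $\widetilde S(s,r)\in\widetilde B_{m+1}$ for $s\in\widetilde B_{n+1},r\in\widetilde B_{m+2}$ with $\partial(s)=ft^{m+1-n}(\partial r)$. It is a non-unital B0-system if, for $m\ge n\ge0$ and arguments in these domains: $B_0=\{pt\}$; $ft(T(Y,X))=T(Y,ft(X))$ if $m>n$ and $=Y$ if $m=n$; $\partial(\widetilde T(Y,r))=T(Y,\partial r)$; $ft(S(s,X))=S(s,ft(X))$ if $m>n$ and $=ft(\partial s)$ if $m=n$; $\partial(\widetilde S(s,r))=S(s,\partial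 r)$. A family $\delta:B_{n+1}\to\widetilde B_{n+2}$ makes it a unital B0-system if $\partial(\delta(X))=T(X,X)$ for all $X\in B_{n+1}$. Notation: for $Y\in B_i$ and $j\ge0$, $B(Y)_j=\{X\in B_{i+j}\mid ft^j(X)=Y\}$ and $\widetilde B(Y)_j=\{r\in\widetilde B_{i+j}\mid ft^j(\partial r)=Y\}$. Conditions on $\delta$: ($\delta$T) for all $GT\in B_{i+1}$, $j\ge0$, $GDT'\in B(ft(GT))_{j+1}$: $\widetilde T(GT,\delta(GDT'))=\delta(T(GT,GDT'))$. ($\delta$Sid) for all $s\in\widetilde B_{i+1}$: $\widetilde S(s,\delta(\partial(s)))=s$. (S$\delta$T) for all $GT\in B_{i+1}$: (a) for all $k\ge1$ and $R\in B(GT)_k$, $S(\delta(GT),T(GT,R))=R$; (b) for all $k\ge1$ and $r\in\widetilde B(GT)_k$, $\widetilde S(\delta(GT),\widetilde T(GT,r))=r$. -}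

module Defs where

open import Data.Nat using (ℕ; zero; suc; _+_)
open import Data.Nat.Properties using (+-suc)
open import Data.Product using (_×_)
open import Relation.Binary.PropositionalEquality using (_≡_; refl; sym; trans; cong; subst)

-- Iterated ft restricted to positive levels:
-- ftIter B ft k : B (suc (k + n)) → B (suc n) is ft^k.
-- Hence ft^(k+1) X (landing in B n) is  ft (ftIter B ft k X).
ftIter : (B : ℕ → Set) (ft : ∀ {n} → B (suc n) → B n) →
         ∀ k {n} → B (suc (k + n)) → B (suc n)
ftIter B ft zero    X = X
ftIter B ft (suc k) X = ftIter B ft k (ft X)

-- Conventions:
--   B n      is B_n
--   B~ n     is \widetilde B_{n+1}   (so ∂ : B~ n → B (suc n))
--   an operation "for m ≥ n" is indexed by k = m - n, i.e. m = k + n.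
-- The side conditions of T, T~, S, S~ are irrelevant arguments, so the
-- operations do not depend on the proofs (the B_n are sets).
record PreBSystem : Set₁ where
  field
    B  : ℕ → Set
    B~ : ℕ → Set
    ft : ∀ {n} → B (suc n) → B n
    ∂  : ∀ {n} → B~ n → B (suc n)
    pt : B 0
    T  : ∀ {n} k (Y : B (suc n)) (X : B (suc (k + n))) →
         .(ft Y ≡ ft (ftIter B ft k {n} X)) → B (suc (suc (k + n)))
    T~ : ∀ {n} k (Y : B (suc n)) (r : B~ (k + n)) →
         .(ft Y ≡ ft (ftIter B ft k {n} (∂ r))) → B~ (suc (k + n))
    S  : ∀ {n} k (s : B~ n) (X : B (suc (suc (k + n)))) →
         .(∂ s ≡ ftIter B ft (suc k) {n} X) → B (suc (k + n))
    S~ : ∀ {n} k (s : B~ n) (r : B~ (suc (k + n))) →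
         .(∂ s ≡ ftIter B ft (suc k) {n} (∂ r)) → B~ (k + n)

record B0System : Set₁ where
  field
    pre : PreBSystem
  open PreBSystem pre public
  field
    B0-pt   : (x : B 0) → x ≡ pt
    ft-T-suc  : ∀ {n} k (Y : B (suc n)) (X : B (suc (suc k + n)))
                .(p : ft Y ≡ ft (ftIter B ft (suc k) {n} X)) →
                ft (T (suc k) Y X p) ≡ T k Y (ft X) p
    ft-T-zero : ∀ {n} (Y : B (suc n)) (X : B (suc (zero + n)))
                .(p : ft Y ≡ ft (ftIter B ft zero {n} X)) →
                ft (T zero Y X p) ≡ Y
    ∂-T~      : ∀ {n} k (Y : B (suc n)) (r : B~ (k + n))
                .(p : ft Y ≡ ft (ftIter B ft k {n} (∂ r))) →
                ∂ (T~ k Y r p) ≡ T k Y (∂ r) p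
    ft-S-suc  : ∀ {n} k (s : B~ n) (X : B (suc (suc (suc k + n))))
                .(p : ∂ s ≡ ftIter B ft (suc (suc k)) {n} X) →
                ft (S (suc k) s X p) ≡ S k s (ft X) p
    ft-S-zero : ∀ {n} (s : B~ n) (X : B (suc (suc (zero + n))))
                .(p : ∂ s ≡ ftIter B ft (suc zero) {n} X) →
                ft (S zero s X p) ≡ ft (∂ s)
    ∂-S~      : ∀ {n} k (s : B~ n) (r : B~ (suc (k + n)))
                .(p : ∂ s ≡ ftIter B ft (suc k) {n} (∂ r)) →
                ∂ (S~ k s r p) ≡ S k s (∂ r) p

module _ (𝔅 : B0System) where
  open B0System 𝔅

  Delta : Set
  Delta = ∀ {n} → B (suc n) → B~ (suc n)

  IsUnital : Delta → Set
  IsUnital δ = ∀ {n} (X : B (suc n)) → ∂ (δ X) ≡ T zero X X refl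

  ft∂δ : (δ : Delta) → IsUnital δ → ∀ {n} (X : B (suc n)) → ft (∂ (δ X)) ≡ X
  ft∂δ δ u X = trans (cong ft (u X)) (ft-T-zero X X refl)

  δT-cond : (δ : Delta) → IsUnital δ → Set
  δT-cond δ u = ∀ {i} (GT : B (suc i)) (j : ℕ) (GDT' : B (suc (j + i)))
    (h : ft (ftIter B ft j {i} GDT') ≡ ft GT) →
    T~ (suc j) GT (δ GDT')
       (trans (sym h) (cong (λ Z → ft (ftIter B ft j {i} Z)) (sym (ft∂δ δ u GDT'))))
      ≡ δ (T j GT GDT' (sym h))

  δSid-cond : (δ : Delta) → IsUnital δ → Set
  δSid-cond δ u = ∀ {i} (s : B~ i) →
    S~ zero s (δ (∂ s)) (sym (ft∂δ δ u (∂ s))) ≡ s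

  -- (SδT): for GT ∈ B_{i+1} and k = suc k' ≥ 1.
  -- The level m = k + i of T's output has to be re-read as k' + (i+1) to
  -- feed it to S at base i+1; this is done by transport along +-suc.
  -- The (always satisfiable) side condition of S / S~ is universally
  -- quantified (irrelevantly).
  SδT-cond : (δ : Delta) → Set
  SδT-cond δ =
    (∀ {i} (GT : B (suc i)) (k' : ℕ) (R : B (suc (suc k' + i)))
       (h : ftIter B ft (suc k') {i} R ≡ GT) →
       let X' = subst (λ l → B (suc (suc l))) (sym (+-suc k' i))
                      (T (suc k') GT R (cong ft (sym h))) in
       .(p : ∂ (δ GT) ≡ ftIter B ft (suc k') {suc i} X') →
       S k' (δ GT) X' p ≡ subst (λ l → B (suc l)) (sym (+-suc k' i)) R)
    ×
    (∀ {i} (GT : B (suc i)) (k' : ℕ) (r : B~ (suc k' + i))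
       (h : ftIter B ft (suc k') {i} (∂ r) ≡ GT) →
       let r' = subst (λ l → B~ (suc l)) (sym (+-suc k' i))
                      (T~ (suc k') GT r (cong ft (sym h))) in
       .(p : ∂ (δ GT) ≡ ftIter B ft (suc k') {suc i} (∂ r')) →
       S~ k' (δ GT) r' p ≡ subst B~ (sym (+-suc k' i)) r)

module Submission where

-- Let X ∈ B_{n+1} and let δ₁, δ₂ be units.  The element r = δ₁ X lies in
-- B~(X)_1, since ft (∂ (δ₁ X)) = ft (T(X,X)) = X.  Then
--
--   δ₁ X = S~(δ₂ X, T~(X, δ₁ X))     by (SδT)(b) for δ₂,
--        = S~(δ₂ X, δ₁ (T(X,X)))     by (δT) for δ₁ with j = 0,
--        = S~(δ₂ X, δ₁ (∂ (δ₂ X)))   by unitality of δ₂,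
--        = δ₂ X                      by (δSid) for δ₁.

open import Defs
open import Data.Nat using (suc; zero)
open import Data.Product using (proj₂)
open import Relation.Binary.PropositionalEquality
  using (_≡_; refl; sym; trans; cong; module ≡-Reasoning)

module UnitUniqueness (𝔅 : B0System) where
  open B0System 𝔅

  -- S~(s, -) respects equality of its second argument; the side conditions
  -- are irrelevant, so they may be chosen independently on both sides.
  S~-cong : ∀ {n} (s : B~ n) {r r' : B~ (suc n)} → r ≡ r' →
            .(p : ∂ s ≡ ft (∂ r)) .(p' : ∂ s ≡ ft (∂ r')) →
            S~ zero s r p ≡ S~ zero s r' p'
  S~-cong s refl p p' = refl

  T-diagonal : ∀ {n} (X : B (suc n)) {Z : B (suc n)} → Z ≡ X →
               .(q : ft X ≡ ft Z) → T zero X Z q ≡ T zero X X refl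
  T-diagonal X refl q = refl

  ft∂-T~ : ∀ {n} (X : B (suc n)) (r : B~ (suc n)) (h : ft (∂ r) ≡ X)
           .(q : ft X ≡ ft (ft (∂ r))) →
           ft (∂ (T~ (suc zero) X r q)) ≡ T zero X X refl
  ft∂-T~ X r h q = begin
    ft (∂ (T~ (suc zero) X r q))   ≡⟨ cong ft (∂-T~ (suc zero) X r q) ⟩
    ft (T (suc zero) X (∂ r) q)    ≡⟨ ft-T-suc zero X (∂ r) q ⟩
    T zero X (ft (∂ r)) q          ≡⟨ T-diagonal X h q ⟩
    T zero X X refl                ∎
    where open ≡-Reasoning

  unit-unique : (δ₁ δ₂ : Delta 𝔅) (u₁ : IsUnital 𝔅 δ₁) (u₂ : IsUnital 𝔅 δ₂) →
    δT-cond 𝔅 δ₁ u₁ → δSid-cond 𝔅 δ₁ u₁ → SδT-cond 𝔅 δ₂ →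
    ∀ {n} (X : B (suc n)) → δ₁ X ≡ δ₂ X
  unit-unique δ₁ δ₂ u₁ u₂ δT₁ δSid₁ SδT₂ X = begin
    δ₁ X                                ≡⟨ sym (proj₂ SδT₂ X zero (δ₁ X) δ₁X∈B~X p) ⟩
    S~ zero (δ₂ X) (T~ (suc zero) X (δ₁ X) q) p
                                        ≡⟨ S~-cong (δ₂ X) T~δ₁≡δ₁∂δ₂ p p′ ⟩
    S~ zero (δ₂ X) (δ₁ (∂ (δ₂ X))) p′   ≡⟨ δSid₁ (δ₂ X) ⟩
    δ₂ X                                ∎
    where
      open ≡-Reasoning

      δ₁X∈B~X : ft (∂ (δ₁ X)) ≡ X
      δ₁X∈B~X = ft∂δ 𝔅 δ₁ u₁ X

      q : ft X ≡ ft (ft (∂ (δ₁ X)))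
      q = cong ft (sym δ₁X∈B~X)

      p : ∂ (δ₂ X) ≡ ft (∂ (T~ (suc zero) X (δ₁ X) q))
      p = trans (u₂ X) (sym (ft∂-T~ X (δ₁ X) δ₁X∈B~X q))

      p′ : ∂ (δ₂ X) ≡ ft (∂ (δ₁ (∂ (δ₂ X))))
      p′ = sym (ft∂δ 𝔅 δ₁ u₁ (∂ (δ₂ X)))

      T~δ₁≡δ₁∂δ₂ : T~ (suc zero) X (δ₁ X) q ≡ δ₁ (∂ (δ₂ X))
      T~δ₁≡δ₁∂δ₂ = trans (δT₁ X zero X refl) (cong δ₁ (sym (u₂ X)))

lemma3p4 : (𝔅 : B0System) (δ₁ δ₂ : Delta 𝔅)
    (u₁ : IsUnital 𝔅 δ₁) (u₂ : IsUnital 𝔅 δ₂) →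
    δT-cond 𝔅 δ₁ u₁ → δSid-cond 𝔅 δ₁ u₁ → SδT-cond 𝔅 δ₁ →
    δT-cond 𝔅 δ₂ u₂ → δSid-cond 𝔅 δ₂ u₂ → SδT-cond 𝔅 δ₂ →
    ∀ {n} (X : B0System.B 𝔅 (suc n)) → δ₁ X ≡ δ₂ X
lemma3p4 𝔅 δ₁ δ₂ u₁ u₂ δT₁ δSid₁ _ _ _ SδT₂ =
  UnitUniqueness.unit-unique 𝔅 δ₁ δ₂ u₁ u₂ δT₁ δSid₁ SδT₂
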